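{- A necklace of size four is topdrop-valid in $S_n$ if and only if it is equivalent (up to cyclic rotation) to $[a,n-1,a,n]$ for some natural number $a$ with $1\le a\le n-2$.
   Context: Permutations are in one-line notation $\pi=\pi_1\cdots\pi_n$. The topdrop map $T:S_n\to S_n$ is $T(\pi_1\cdots\pi_n)=\pi_{\pi_1+1}\cdots\pi_n\,\pi_{\pi_1}\pi_{\pi_1-1}\cdots\pi_1$ (first $\pi_1$ entries removed, reversed, appended at the end); it is a bijection. The orbit of $\pi$ is $(\pi,T(\pi),\dots,T^{s-1}(\pi))$ with $s\ge1$ minimal such that $T^s(\pi)=\pi$. The topdrop-necklace of $\pi$ is the cyclic sequence $[\pi_1,T(\pi)_1,\dots,T^{s-1}(\pi)_1]$, considered up to cyclic rotation; its size is $s$. A necklace is topdrop-valid in $S_n$ if it is the topdrop-necklace of some $\pi\in S_n$. -}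

module Defs where

open import Data.Nat using (ℕ; zero; suc; _≤_; _<_; _∸_)
open import Data.List using (List; []; _∷_; _++_; take; drop; reverse; map; upTo; length)
open import Data.List.Relation.Binary.Permutation.Propositional using (_↭_)
open import Data.Product using (Σ; _×_; ∃; ∃-syntax)
open import Relation.Binary.PropositionalEquality using (_≡_; _≢_)

-- Permutations of {1,…,n} in one-line notation π₁⋯πₙ, represented as lists.
-- π ∈ S_n  iff  π is a rearrangement of [1, 2, …, n].
InS : ℕ → List ℕ → Set
InS n π = π ↭ map suc (upTo n)

-- first entry π₁ (default 0 for the empty list, which only occurs for n = 0)
first : List ℕ → ℕ
first []      = 0
first (x ∷ _) = x

topdrop : List ℕ → List ℕ
topdrop []        = []
topdrop (x ∷ xs)  = drop x (x ∷ xs) ++ reverse (take x (x ∷ xs))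

iterT : ℕ → List ℕ → List ℕ
iterT zero    π = π
iterT (suc k) π = topdrop (iterT k π)

OrbitSize : List ℕ → ℕ → Set
OrbitSize π s = (1 ≤ s) × (iterT s π ≡ π) × (∀ k → 1 ≤ k → k < s → iterT k π ≢ π)

neckSeq : List ℕ → ℕ → List ℕ
neckSeq π s = map (λ i → first (iterT i π)) (upTo s)

rotate : ℕ → List ℕ → List ℕ
rotate k xs = drop k xs ++ take k xs

CyclicEq : List ℕ → List ℕ → Set
CyclicEq xs ys = ∃[ k ] (k < length xs × rotate k xs ≡ ys)

IsTopdropNecklace : List ℕ → List ℕ → Set
IsTopdropNecklace π c = ∃[ s ] (OrbitSize π s × CyclicEq (neckSeq π s) c)

TopdropValid : ℕ → List ℕ → Set
TopdropValid n c = ∃[ π ] (InS n π × IsTopdropNecklace π c)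

-- Write cᵢ for the first entry of πᵢ along an orbit π₀ ↦ π₁ ↦ π₂ ↦ π₃ ↦ π₀ in Sₙ. A move
-- with first entry c puts c last, moves an entry at index i ≥ c to i − c and mirrors an
-- entry at index i < c to n − 1 − i; moreover the next first entry is the entry at index c,
-- so it differs from c whenever c < n. If no cᵢ equals n, following c₀ from the end of π₁
-- back to the front of π₀ yields c₁ + c₂ + c₃ = n − 1, or c₃ = c₁ and c₁ + c₂ ≥ n; the same
-- holds for the rotated orbit, and every combination of the two alternatives contradicts
-- the arithmetic or makes two consecutive first entries equal. Hence some cᵢ = n, say c₀.
-- Then π₁ is the reverse of π₀, so c₁ = c₃; if c₁ ≥ n − 1 then π₂ would be π₀ again, so
-- c₁ ≤ n − 2, and c₂ = n − 1 because c₂ is the index of c₃ = c₁, which sits last in π₂.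
-- Conversely X ++ Y ↦ Y ++ Xʳ ↦ X ++ Yʳ ↦ Yʳ ++ Xʳ ↦ X ++ Y for X = a,1,…,a−1 and
-- Y = n−1,a+1,…,n−2,n, an orbit with necklace [a, n−1, a, n].
module Submission where

open import Defs
open import Data.Empty using (⊥; ⊥-elim)
open import Data.List
  using (List; []; _∷_; _++_; _∷ʳ_; take; drop; reverse; map; applyUpTo; upTo; length)
open import Data.List.Properties
  using ( length-map; length-++; length-take; length-drop; length-reverse; length-applyUpTo
        ; length-upTo; ++-assoc; ++-identityʳ; ++-cancelˡ; take++drop≡id; unfold-reverse
        ; reverse-++; reverse-involutive; applyUpTo-∷ʳ; map-applyUpTo)
open import Data.List.Membership.Propositional.Properties using (∈-map⁻; ∈-upTo⁻)
open import Data.List.Relation.Binary.Permutation.Propositional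
  using (_↭_; prep; ↭-sym; ↭-trans; ↭-reflexive; ↭⇒↭ₛ)
open import Data.List.Relation.Binary.Permutation.Propositional.Properties
  using (↭-length; ↭-empty-inv; ↭-reverse; ∈-resp-↭; ++-comm; ++⁺ˡ; ++⁺ʳ; shift)
open import Data.List.Relation.Unary.All using (All; _∷_)
open import Data.List.Relation.Unary.AllPairs using (_∷_)
import Data.List.Relation.Unary.Any as Any
open import Data.List.Relation.Unary.Unique.Propositional using (Unique)
open import Data.List.Relation.Unary.Unique.Propositional.Properties using (map⁺; upTo⁺)
open import Data.Nat using (ℕ; zero; suc; _+_; _∸_; _≤_; _<_; z≤n; s≤s; z<s; s<s; _≟_)
open import Data.Nat.Properties
open import Data.Nat.Tactic.RingSolver using (solve-∀)
open import Data.Product using (_×_; _,_; ∃-syntax; proj₁; proj₂)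
open import Data.Sum using (_⊎_; inj₁; inj₂)
open import Function using (_∘_)
open import Function.Bundles using (_⇔_; mk⇔)
open import Relation.Binary.PropositionalEquality
  using (_≡_; _≢_; refl; sym; trans; cong; cong₂; subst; subst₂; setoid; module ≡-Reasoning)
open import Data.List.Relation.Binary.Permutation.Setoid.Properties (setoid ℕ) using (Unique-resp-↭)
open import Relation.Nullary using (yes; no)

private variable
  A : Set
  x : A
  xs ys : List A
  c i j m n : ℕ
  σ : List ℕ

infix 4 _[_]=_

data _[_]=_ {A : Set} : List A → ℕ → A → Set where
  here  : (x ∷ xs) [ 0 ]= x
  there : ∀ {y} → xs [ i ]= x → (y ∷ xs) [ suc i ]= x

[]=⇒< : xs [ i ]= x → i < length xs
[]=⇒< here      = z<s
[]=⇒< (there p) = s<s ([]=⇒< p)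

[]=-++ˡ : xs [ i ]= x → (xs ++ ys) [ i ]= x
[]=-++ˡ here      = here
[]=-++ˡ (there p) = there ([]=-++ˡ p)

[]=-++ʳ : ∀ xs → ys [ i ]= x → (xs ++ ys) [ length xs + i ]= x
[]=-++ʳ []       p = p
[]=-++ʳ (_ ∷ xs) p = there ([]=-++ʳ xs p)

[]=-++⁻ : ∀ xs → (xs ++ ys) [ i ]= x → xs [ i ]= x ⊎ ∃[ j ] (i ≡ length xs + j × ys [ j ]= x)
[]=-++⁻ []       p         = inj₂ (_ , refl , p)
[]=-++⁻ (_ ∷ xs) here      = inj₁ here
[]=-++⁻ (_ ∷ xs) (there p) with []=-++⁻ xs p
... | inj₁ q              = inj₁ (there q)
... | inj₂ (j , refl , q) = inj₂ (j , refl , q)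

[]=-reverse : xs [ i ]= x → ∃[ j ] (suc (i + j) ≡ length xs × reverse xs [ j ]= x)
[]=-reverse {xs = x ∷ xs} here =
  length xs , refl ,
  subst₂ (λ zs k → zs [ k ]= x) (sym (unfold-reverse x xs)) (trans (+-identityʳ _) (length-reverse xs))
    ([]=-++ʳ (reverse xs) here)
[]=-reverse {xs = y ∷ xs} (there p) with []=-reverse p
... | j , 1+i+j≡|xs| , q = j , cong suc 1+i+j≡|xs| , subst (_[ j ]= _) (sym (unfold-reverse y xs)) ([]=-++ˡ q)

All-[]= : {P : A → Set} → All P xs → xs [ i ]= x → P x
All-[]= (px ∷ _)  here      = px
All-[]= (_ ∷ pxs) (there p) = All-[]= pxs p

[]=-unique-index : Unique xs → xs [ i ]= x → xs [ j ]= x → i ≡ j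
[]=-unique-index _          here      here      = refl
[]=-unique-index (x≢xs ∷ _) here      (there q) = ⊥-elim (All-[]= x≢xs q refl)
[]=-unique-index (x≢xs ∷ _) (there p) here      = ⊥-elim (All-[]= x≢xs p refl)
[]=-unique-index (_ ∷ u)    (there p) (there q) = cong suc ([]=-unique-index u p q)

[]=⇒first : σ [ 0 ]= c → first σ ≡ c
[]=⇒first here = refl

first⇒[]= : 0 < length σ → σ [ 0 ]= first σ
first⇒[]= {_ ∷ _} _ = here

take-++-length : ∀ (xs ys : List A) → take (length xs) (xs ++ ys) ≡ xs
take-++-length []       ys = refl
take-++-length (x ∷ xs) ys = cong (x ∷_) (take-++-length xs ys)

drop-++-length : ∀ (xs ys : List A) → drop (length xs) (xs ++ ys) ≡ ys
drop-++-length []       ys = refl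
drop-++-length (x ∷ xs) ys = drop-++-length xs ys

reverse-drop : ∀ c (xs : List A) → length xs ≤ suc c → reverse (drop c xs) ≡ drop c xs
reverse-drop zero    []          _              = refl
reverse-drop zero    (_ ∷ [])    _              = refl
reverse-drop zero    (_ ∷ _ ∷ _) (s≤s ())
reverse-drop (suc c) []          _              = refl
reverse-drop (suc c) (_ ∷ xs)    (s≤s |xs|≤1+c) = reverse-drop c xs |xs|≤1+c

reverse-++-reverse : ∀ (xs ys : List A) → reverse (xs ++ reverse ys) ≡ ys ++ reverse xs
reverse-++-reverse xs ys = trans (reverse-++ xs (reverse ys)) (cong (_++ reverse xs) (reverse-involutive ys))

applyUpTo-+ : ∀ (f : ℕ → A) i j → applyUpTo f (i + j) ≡ applyUpTo f i ++ applyUpTo (f ∘ (i +_)) j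
applyUpTo-+ f zero    j = refl
applyUpTo-+ f (suc i) j = cong (f 0 ∷_) (applyUpTo-+ (f ∘ suc) i j)

rotate-length : ∀ k (xs : List ℕ) → length (rotate k xs) ≡ length xs
rotate-length k xs = begin
  length (drop k xs ++ take k xs)          ≡⟨ length-++ (drop k xs) ⟩
  length (drop k xs) + length (take k xs)  ≡⟨ +-comm (length (drop k xs)) _ ⟩
  length (take k xs) + length (drop k xs)  ≡⟨ sym (length-++ (take k xs)) ⟩
  length (take k xs ++ drop k xs)          ≡⟨ cong length (take++drop≡id k xs) ⟩
  length xs                                ∎
  where open ≡-Reasoning

rotate-++ : ∀ (xs ys : List ℕ) → rotate (length xs) (xs ++ ys) ≡ ys ++ xs
rotate-++ xs ys = cong₂ _++_ (drop-++-length xs ys) (take-++-length xs ys)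

CyclicEq-length : ∀ {xs ys} → CyclicEq xs ys → length ys ≡ length xs
CyclicEq-length {xs} (k , _ , refl) = rotate-length k xs

CyclicEq-sym : ∀ {xs ys} → CyclicEq xs ys → CyclicEq ys xs
CyclicEq-sym {xs} (zero , 0<|xs| , refl) =
  zero , subst (0 <_) (sym (rotate-length 0 xs)) 0<|xs| , trans (++-identityʳ _) (++-identityʳ xs)
CyclicEq-sym {xs} (suc k , 1+k<|xs| , refl) =
  length D ,
  subst₂ _<_ (sym (length-drop (suc k) xs)) (sym (rotate-length (suc k) xs)) (∸-monoʳ-< z<s (<⇒≤ 1+k<|xs|)) ,
  trans (rotate-++ D (take (suc k) xs)) (take++drop≡id (suc k) xs)
  where
    D : List ℕ
    D = drop (suc k) xs

neckSeq-length : ∀ π s → length (neckSeq π s) ≡ s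
neckSeq-length π s = trans (length-map _ (upTo s)) (length-upTo s)

topdrop-↭ : ∀ σ → topdrop σ ↭ σ
topdrop-↭ []       = ↭-reflexive refl
topdrop-↭ (c ∷ xs) =
  ↭-trans (++-comm (drop c (c ∷ xs)) (reverse (take c (c ∷ xs))))
    (↭-trans (++⁺ʳ (drop c (c ∷ xs)) (↭-reverse (take c (c ∷ xs))))
      (↭-reflexive (take++drop≡id c (c ∷ xs))))

topdrop-split : ∀ P (R : List ℕ) → c ≡ suc (length P) → topdrop (c ∷ P ++ R) ≡ R ++ reverse (c ∷ P)
topdrop-split {c} P R refl =
  cong₂ (λ D T → D ++ reverse (c ∷ T)) (drop-++-length P R) (take-++-length P R)

topdrop-reverse : length σ ≤ suc (first σ) → topdrop σ ≡ reverse σ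
topdrop-reverse {[]}     _         = refl
topdrop-reverse {c ∷ xs} |σ|≤1+c = begin
  drop c π ++ reverse (take c π)            ≡⟨ cong (_++ reverse (take c π)) (sym (reverse-drop c π |σ|≤1+c)) ⟩
  reverse (drop c π) ++ reverse (take c π)  ≡⟨ sym (reverse-++ (take c π) (drop c π)) ⟩
  reverse (take c π ++ drop c π)            ≡⟨ cong reverse (take++drop≡id c π) ⟩
  reverse π                                 ∎
  where
    open ≡-Reasoning
    π : List ℕ
    π = c ∷ xs

first-topdrop-[]= : first σ < length σ → σ [ first σ ]= first (topdrop σ)
first-topdrop-[]= {c ∷ xs} c<|σ| = drop-first c (c ∷ xs) c<|σ|
  where
    drop-first : ∀ k xs {ys} → k < length xs → xs [ k ]= first (drop k xs ++ ys)
    drop-first zero    (x ∷ xs) _         = here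
    drop-first (suc k) (x ∷ xs) (s≤s k<n) = there (drop-first k xs k<n)

topdrop-[]= : first σ ≤ length σ → σ [ i ]= x →
  ∃[ j ] (topdrop σ [ j ]= x × (first σ + j ≡ i ⊎ i < first σ × suc (i + j) ≡ length σ))
topdrop-[]= {c ∷ xs} {i} {x} c≤|σ| p = moved ([]=-++⁻ T (subst (_[ i ]= x) (sym T++D≡σ) p))
  where
    T D : List ℕ
    T = take c (c ∷ xs)
    D = drop c (c ∷ xs)
    T++D≡σ : T ++ D ≡ c ∷ xs
    T++D≡σ = take++drop≡id c (c ∷ xs)
    |T|≡c : length T ≡ c
    |T|≡c = trans (length-take c (c ∷ xs)) (m≤n⇒m⊓n≡m c≤|σ|)
    rearrange : ∀ i d j → suc (i + (d + j)) ≡ suc (i + j) + d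
    rearrange = solve-∀
    moved : T [ i ]= x ⊎ ∃[ j ] (i ≡ length T + j × D [ j ]= x) →
      ∃[ j ] ((D ++ reverse T) [ j ]= x × (c + j ≡ i ⊎ i < c × suc (i + j) ≡ suc (length xs)))
    moved (inj₂ (j , i≡|T|+j , q)) = j , []=-++ˡ q , inj₁ (trans (cong (_+ j) (sym |T|≡c)) (sym i≡|T|+j))
    moved (inj₁ q) with []=-reverse q
    ... | j , 1+i+j≡|T| , r = length D + j , []=-++ʳ D r , inj₂ (subst (i <_) |T|≡c ([]=⇒< q) , (begin
      suc (i + (length D + j))  ≡⟨ rearrange i (length D) j ⟩
      suc (i + j) + length D    ≡⟨ cong (_+ length D) 1+i+j≡|T| ⟩
      length T + length D       ≡⟨ sym (length-++ T) ⟩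
      length (T ++ D)           ≡⟨ cong length T++D≡σ ⟩
      suc (length xs)           ∎))
      where open ≡-Reasoning

InS-length : InS n σ → length σ ≡ n
InS-length {n} σ∈S = trans (↭-length σ∈S) (trans (length-map suc (upTo n)) (length-upTo n))

InS-unique : InS n σ → Unique σ
InS-unique {n} σ∈S = Unique-resp-↭ (↭⇒↭ₛ (↭-sym σ∈S)) (map⁺ suc-injective (upTo⁺ n))

InS-first : InS (suc m) σ → 1 ≤ first σ × first σ ≤ suc m
InS-first {σ = []}    σ∈S with () ← InS-length σ∈S
InS-first {σ = c ∷ _} σ∈S with ∈-map⁻ suc (∈-resp-↭ σ∈S (Any.here refl))
... | k , k∈upTo , refl = z<s , ∈-upTo⁻ k∈upTo

InS-first-below-max : InS (suc m) σ → first σ ≢ suc m → first σ ≤ m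
InS-first-below-max σ∈S c≢1+m = ≤-pred (≤∧≢⇒< (proj₂ (InS-first σ∈S)) c≢1+m)

InS-topdrop : InS n σ → InS n (topdrop σ)
InS-topdrop {σ = σ} = ↭-trans (topdrop-↭ σ)

InS-zero-fixed : InS 0 σ → topdrop σ ≡ σ
InS-zero-fixed σ↭[] with refl ← ↭-empty-inv σ↭[] = refl

module _ {σ τ : List ℕ} (σ∈S : InS (suc m) σ) (σ↦τ : topdrop σ ≡ τ) where

  private
    |σ|≡1+m : length σ ≡ suc m
    |σ|≡1+m = InS-length σ∈S

    first-at-0 : σ [ 0 ]= first σ
    first-at-0 = first⇒[]= (subst (0 <_) (sym |σ|≡1+m) z<s)

  step-[]= : σ [ i ]= x → ∃[ j ] (τ [ j ]= x × (first σ + j ≡ i ⊎ i < first σ × suc (i + j) ≡ suc m))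
  step-[]= p with topdrop-[]= (subst (first σ ≤_) (sym |σ|≡1+m) (proj₂ (InS-first σ∈S))) p
  ... | j , q , inj₁ shifted           = j , subst (_[ j ]= _) σ↦τ q , inj₁ shifted
  ... | j , q , inj₂ (i<c , mirrored)  = j , subst (_[ j ]= _) σ↦τ q , inj₂ (i<c , trans mirrored |σ|≡1+m)

  step-last : τ [ m ]= first σ
  step-last with step-[]= first-at-0
  ... | _ , _ , inj₁ c+j≡0      = ⊥-elim (<⇒≢ (proj₁ (InS-first σ∈S)) (sym (m+n≡0⇒m≡0 _ c+j≡0)))
  ... | _ , p , inj₂ (_ , refl) = p

  step-first-index : first σ ≤ m → σ [ j ]= first τ → first σ ≡ j
  step-first-index c≤m = []=-unique-index (InS-unique σ∈S)
    (subst (σ [ first σ ]=_) (cong first σ↦τ) (first-topdrop-[]= (subst (first σ <_) (sym |σ|≡1+m) (s≤s c≤m))))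

  step-first-≢ : first σ ≤ m → first τ ≢ first σ
  step-first-≢ c≤m c′≡c =
    <⇒≢ (proj₁ (InS-first σ∈S)) (sym (step-first-index c≤m (subst (σ [ 0 ]=_) (sym c′≡c) first-at-0)))

  step-reverse : m ≤ first σ → τ ≡ reverse σ
  step-reverse m≤c = trans (sym σ↦τ) (topdrop-reverse {σ} (subst (_≤ suc (first σ)) (sym |σ|≡1+m) (s≤s m≤c)))


necklace₄ : List ℕ → List ℕ → List ℕ → List ℕ → List ℕ
necklace₄ π₀ π₁ π₂ π₃ = first π₀ ∷ first π₁ ∷ first π₂ ∷ first π₃ ∷ []

-- An orbit of size exactly 4 in S_(suc m); as the size divides 4, π₀ ≢ π₂ is all it takes.
record Orbit₄ (m : ℕ) (π₀ π₁ π₂ π₃ : List ℕ) : Set where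
  field
    π₀∈S  : InS (suc m) π₀
    step₀ : topdrop π₀ ≡ π₁
    step₁ : topdrop π₁ ≡ π₂
    step₂ : topdrop π₂ ≡ π₃
    step₃ : topdrop π₃ ≡ π₀
    π₀≢π₂ : π₀ ≢ π₂

  π₁∈S : InS (suc m) π₁
  π₁∈S = subst (InS (suc m)) step₀ (InS-topdrop π₀∈S)

  π₂∈S : InS (suc m) π₂
  π₂∈S = subst (InS (suc m)) step₁ (InS-topdrop π₁∈S)

  π₃∈S : InS (suc m) π₃
  π₃∈S = subst (InS (suc m)) step₂ (InS-topdrop π₂∈S)

  π₁≢π₃ : π₁ ≢ π₃
  π₁≢π₃ π₁≡π₃ = π₀≢π₂ (trans (sym step₃) (trans (cong topdrop (sym π₁≡π₃)) step₁))

  π₁≢π₀ : π₁ ≢ π₀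
  π₁≢π₀ π₁≡π₀ = π₀≢π₂ (sym (trans (sym step₁) (trans (cong topdrop π₁≡π₀) (trans step₀ π₁≡π₀))))

  π₃≢π₀ : π₃ ≢ π₀
  π₃≢π₀ π₃≡π₀ = π₁≢π₀ (trans (sym step₀) (trans (cong topdrop (sym π₃≡π₀)) step₃))

  iterT-π₂ : iterT 2 π₀ ≡ π₂
  iterT-π₂ = trans (cong topdrop step₀) step₁

  iterT-π₃ : iterT 3 π₀ ≡ π₃
  iterT-π₃ = trans (cong topdrop iterT-π₂) step₂

  neckSeq-π₀ : neckSeq π₀ 4 ≡ necklace₄ π₀ π₁ π₂ π₃
  neckSeq-π₀ = cong (first π₀ ∷_)
    (cong₂ _∷_ (cong first step₀) (cong₂ _∷_ (cong first iterT-π₂) (cong (λ π → first π ∷ []) iterT-π₃)))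

rotateOrbit : ∀ {π₀ π₁ π₂ π₃} → Orbit₄ m π₀ π₁ π₂ π₃ → Orbit₄ m π₁ π₂ π₃ π₀
rotateOrbit O = record
  { π₀∈S = π₁∈S ; step₀ = step₁ ; step₁ = step₂ ; step₂ = step₃ ; step₃ = step₀ ; π₀≢π₂ = π₁≢π₃ }
  where open Orbit₄ O

orbit₄-size : ∀ {π₀ π₁ π₂ π₃} → Orbit₄ m π₀ π₁ π₂ π₃ → OrbitSize π₀ 4
orbit₄-size {π₀ = π₀} O = z<s , trans (cong topdrop iterT-π₃) step₃ , not-earlier
  where
    open Orbit₄ O
    not-earlier : ∀ k → 1 ≤ k → k < 4 → iterT k π₀ ≢ π₀
    not-earlier 1 _ _ = π₁≢π₀ ∘ trans (sym step₀)
    not-earlier 2 _ _ T²π₀≡π₀ = π₀≢π₂ (trans (sym T²π₀≡π₀) iterT-π₂)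
    not-earlier 3 _ _ = π₃≢π₀ ∘ trans (sym iterT-π₃)
    not-earlier (suc (suc (suc (suc _)))) _ (s<s (s<s (s<s (s<s ()))))

orbit₄-iterT : ∀ {π} → InS (suc m) π → OrbitSize π 4 → Orbit₄ m π (iterT 1 π) (iterT 2 π) (iterT 3 π)
orbit₄-iterT π∈S (_ , T⁴π≡π , minimal) = record
  { π₀∈S = π∈S ; step₀ = refl ; step₁ = refl ; step₂ = refl ; step₃ = T⁴π≡π
  ; π₀≢π₂ = λ π≡T²π → minimal 2 (s≤s z≤n) (s<s (s<s z<s)) (sym π≡T²π) }

module _ {m π₀ π₁ π₂ π₃} (O : Orbit₄ m π₀ π₁ π₂ π₃) where
  open Orbit₄ O

  -- Follow the entry first π₀ from the end of π₁ back to the front of π₀.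
  orbit₄-trajectory : first π₁ ≤ m → first π₃ ≤ m →
    first π₁ + (first π₂ + first π₃) ≡ m ⊎ (first π₃ ≡ first π₁ × m < first π₁ + first π₂)
  orbit₄-trajectory c₁≤m c₃≤m with step-[]= π₁∈S step₁ (step-last π₀∈S step₀)
  ... | _  , _  , inj₂ (m<c₁ , _) = ⊥-elim (<⇒≱ m<c₁ c₁≤m)
  ... | j₂ , p₂ , inj₁ c₁+j₂≡m with step-[]= π₂∈S step₂ p₂
  ...   | j₃ , p₃ , inj₁ c₂+j₃≡j₂ =
    inj₁ (trans (cong (first π₁ +_) (trans (cong (first π₂ +_) c₃≡j₃) c₂+j₃≡j₂)) c₁+j₂≡m)
    where
      c₃≡j₃ : first π₃ ≡ j₃
      c₃≡j₃ = step-first-index π₃∈S step₃ c₃≤m p₃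
  ...   | j₃ , p₃ , inj₂ (j₂<c₂ , 1+j₂+j₃≡1+m) =
    inj₂ (trans c₃≡j₃ j₃≡c₁ , subst (_< first π₁ + first π₂) c₁+j₂≡m (+-monoʳ-< (first π₁) j₂<c₂))
    where
      c₃≡j₃ : first π₃ ≡ j₃
      c₃≡j₃ = step-first-index π₃∈S step₃ c₃≤m p₃
      j₃≡c₁ : j₃ ≡ first π₁
      j₃≡c₁ = +-cancelˡ-≡ j₂ _ _
        (trans (suc-injective 1+j₂+j₃≡1+m) (trans (sym c₁+j₂≡m) (+-comm (first π₁) j₂)))

  orbit₄-after-max : first π₀ ≡ suc m →
    ∃[ a ] (1 ≤ a × a ≤ m ∸ 1 × necklace₄ π₁ π₂ π₃ π₀ ≡ a ∷ m ∷ a ∷ suc m ∷ [])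
  orbit₄-after-max c₀≡1+m =
    first π₁ , proj₁ (InS-first π₁∈S) , <⇒≤pred c₁<m ,
    cong (first π₁ ∷_) (cong₂ _∷_ c₂≡m (cong₂ _∷_ (sym c₁≡c₃) (cong (_∷ []) c₀≡1+m)))
    where
      π₁≡π₀ʳ : π₁ ≡ reverse π₀
      π₁≡π₀ʳ = step-reverse π₀∈S step₀ (subst (m ≤_) (sym c₀≡1+m) (n≤1+n m))

      c₁≡c₃ : first π₁ ≡ first π₃
      c₁≡c₃ with []=-reverse (step-last π₃∈S step₃)
      ... | j , 1+m+j≡|π₀| , p = []=⇒first (subst₂ (λ π k → π [ k ]= first π₃) (sym π₁≡π₀ʳ) j≡0 p)
        where
          j≡0 : j ≡ 0
          j≡0 = +-cancelˡ-≡ m j 0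
            (trans (suc-injective (trans 1+m+j≡|π₀| (InS-length π₀∈S))) (sym (+-identityʳ m)))

      c₁<m : first π₁ < m
      c₁<m = ≰⇒> λ m≤c₁ → π₀≢π₂ (sym (begin
        π₂                    ≡⟨ step-reverse π₁∈S step₁ m≤c₁ ⟩
        reverse π₁            ≡⟨ cong reverse π₁≡π₀ʳ ⟩
        reverse (reverse π₀)  ≡⟨ reverse-involutive π₀ ⟩
        π₀                    ∎))
        where open ≡-Reasoning

      c₂≤m : first π₂ ≤ m
      c₂≤m = InS-first-below-max π₂∈S λ c₂≡1+m →
        <⇒≢ c₁<m (step-first-index π₁∈S step₁ (<⇒≤ c₁<m)
          (subst (π₁ [ m ]=_) (trans c₀≡1+m (sym c₂≡1+m)) (step-last π₀∈S step₀)))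

      c₂≡m : first π₂ ≡ m
      c₂≡m = step-first-index π₂∈S step₂ c₂≤m (subst (π₂ [ m ]=_) c₁≡c₃ (step-last π₁∈S step₁))

orbit₄-not-below-max : ∀ {π₀ π₁ π₂ π₃} → Orbit₄ m π₀ π₁ π₂ π₃ →
  first π₀ ≤ m → first π₁ ≤ m → first π₂ ≤ m → first π₃ ≤ m → ⊥
orbit₄-not-below-max {m} {π₀} {π₁} {π₂} {π₃} O c₀≤m c₁≤m c₂≤m c₃≤m
  with orbit₄-trajectory O c₁≤m c₃≤m | orbit₄-trajectory (rotateOrbit O) c₂≤m c₀≤m
... | inj₁ sum₁ | inj₁ sum₂ = step-first-≢ π₀∈S step₀ c₀≤m c₁≡c₀
  where
    open Orbit₄ O
    c₁≡c₀ : first π₁ ≡ first π₀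
    c₁≡c₀ = +-cancelˡ-≡ (first π₂ + first π₃) _ _ (begin
      first π₂ + first π₃ + first π₁    ≡⟨ +-comm (first π₂ + first π₃) (first π₁) ⟩
      first π₁ + (first π₂ + first π₃)  ≡⟨ trans sum₁ (sym sum₂) ⟩
      first π₂ + (first π₃ + first π₀)  ≡⟨ sym (+-assoc (first π₂) (first π₃) (first π₀)) ⟩
      first π₂ + first π₃ + first π₀    ∎)
      where open ≡-Reasoning
... | inj₁ sum₁ | inj₂ (_ , m<c₂+c₃) =
  <⇒≱ m<c₂+c₃ (subst (first π₂ + first π₃ ≤_) sum₁ (m≤n+m (first π₂ + first π₃) (first π₁)))
... | inj₂ (c₃≡c₁ , m<c₁+c₂) | inj₁ sum₂ = <⇒≱ m<c₁+c₂ (begin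
  first π₁ + first π₂               ≡⟨ +-comm (first π₁) (first π₂) ⟩
  first π₂ + first π₁               ≡⟨ cong (first π₂ +_) (sym c₃≡c₁) ⟩
  first π₂ + first π₃               ≤⟨ +-monoʳ-≤ (first π₂) (m≤m+n (first π₃) (first π₀)) ⟩
  first π₂ + (first π₃ + first π₀)  ≡⟨ sum₂ ⟩
  m                                 ∎)
  where open ≤-Reasoning
... | inj₂ (c₃≡c₁ , _) | inj₂ (c₀≡c₂ , _) = step-first-≢ π₁∈S step₁ c₁≤m (trans c₂≡m (sym c₁≡m))
  where
    open Orbit₄ O
    c₁≡m : first π₁ ≡ m
    c₁≡m = step-first-index π₁∈S step₁ c₁≤m (subst (π₁ [ m ]=_) c₀≡c₂ (step-last π₀∈S step₀))
    c₂≡m : first π₂ ≡ m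
    c₂≡m = step-first-index π₂∈S step₂ c₂≤m (subst (π₂ [ m ]=_) (sym c₃≡c₁) (step-last π₁∈S step₁))

StandardNecklace : ℕ → List ℕ → Set
StandardNecklace n c = ∃[ a ] (1 ≤ a × a ≤ n ∸ 2 × CyclicEq c (a ∷ n ∸ 1 ∷ a ∷ n ∷ []))

rotate-standard : ∀ k {xs} → k < length xs →
  ∃[ a ] (1 ≤ a × a ≤ m ∸ 1 × rotate k xs ≡ a ∷ m ∷ a ∷ suc m ∷ []) → StandardNecklace (suc m) xs
rotate-standard k k<|xs| (a , 1≤a , a≤m∸1 , rotated) = a , 1≤a , a≤m∸1 , k , k<|xs| , rotated

orbit₄-necklace : ∀ {π₀ π₁ π₂ π₃} → Orbit₄ m π₀ π₁ π₂ π₃ → StandardNecklace (suc m) (necklace₄ π₀ π₁ π₂ π₃)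
orbit₄-necklace {m} {π₀} {π₁} {π₂} {π₃} O
  with first π₀ ≟ suc m | first π₁ ≟ suc m | first π₂ ≟ suc m | first π₃ ≟ suc m
... | yes c₀≡1+m | _ | _ | _ =
  rotate-standard 1 (s<s z<s) (orbit₄-after-max O c₀≡1+m)
... | no _ | yes c₁≡1+m | _ | _ =
  rotate-standard 2 (s<s (s<s z<s)) (orbit₄-after-max (rotateOrbit O) c₁≡1+m)
... | no _ | no _ | yes c₂≡1+m | _ =
  rotate-standard 3 (s<s (s<s (s<s z<s))) (orbit₄-after-max (rotateOrbit (rotateOrbit O)) c₂≡1+m)
... | no _ | no _ | no _ | yes c₃≡1+m =
  rotate-standard 0 z<s (orbit₄-after-max (rotateOrbit (rotateOrbit (rotateOrbit O))) c₃≡1+m)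
... | no c₀≢1+m | no c₁≢1+m | no c₂≢1+m | no c₃≢1+m = ⊥-elim (orbit₄-not-below-max O
  (InS-first-below-max π₀∈S c₀≢1+m) (InS-first-below-max π₁∈S c₁≢1+m)
  (InS-first-below-max π₂∈S c₂≢1+m) (InS-first-below-max π₃∈S c₃≢1+m))
  where open Orbit₄ O

orbit₄-cyclicEq : ∀ {π₀ π₁ π₂ π₃ c} → Orbit₄ m π₀ π₁ π₂ π₃ →
  CyclicEq (necklace₄ π₀ π₁ π₂ π₃) c → StandardNecklace (suc m) c
orbit₄-cyclicEq O (0 , _ , refl) = orbit₄-necklace O
orbit₄-cyclicEq O (1 , _ , refl) = orbit₄-necklace (rotateOrbit O)
orbit₄-cyclicEq O (2 , _ , refl) = orbit₄-necklace (rotateOrbit (rotateOrbit O))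
orbit₄-cyclicEq O (3 , _ , refl) = orbit₄-necklace (rotateOrbit (rotateOrbit (rotateOrbit O)))
orbit₄-cyclicEq O (suc (suc (suc (suc _))) , s<s (s<s (s<s (s<s ()))) , _)

valid⇒standard : ∀ {n c} → length c ≡ 4 → TopdropValid n c → StandardNecklace n c
valid⇒standard {n} |c|≡4 (π , π∈S , s , size , necklace)
  with trans (sym (neckSeq-length π s)) (trans (sym (CyclicEq-length necklace)) |c|≡4)
... | refl with n
...   | zero  = ⊥-elim (proj₂ (proj₂ size) 1 ≤-refl (s<s z<s) (InS-zero-fixed π∈S))
...   | suc m = orbit₄-cyclicEq (orbit₄-iterT π∈S size) necklace

module Witness (a′ k : ℕ) where
  a m′ : ℕ
  a  = suc a′
  m′ = suc (a + k)

  L B X Y : List ℕ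
  L = applyUpTo suc a′
  B = applyUpTo (suc ∘ (a +_)) k
  X = a ∷ L
  Y = m′ ∷ B ++ suc m′ ∷ []

  π₀ π₁ π₂ π₃ : List ℕ
  π₀ = X ++ Y
  π₁ = Y ++ reverse X
  π₂ = X ++ reverse Y
  π₃ = reverse Y ++ reverse X

  π₀∈S : InS (suc m′) π₀
  π₀∈S = ↭-trans (↭-sym (shift a L Y)) (↭-trans (++⁺ˡ L (prep a (↭-sym (shift m′ B (suc m′ ∷ [])))))
    (↭-reflexive (begin
      L ++ a ∷ B ++ m′ ∷ suc m′ ∷ []              ≡⟨ sym (++-assoc L (a ∷ []) _) ⟩
      (L ∷ʳ a) ++ B ++ m′ ∷ suc m′ ∷ []           ≡⟨ sym (++-assoc (L ∷ʳ a) B _) ⟩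
      ((L ∷ʳ a) ++ B) ++ m′ ∷ suc m′ ∷ []         ≡⟨ cong (λ xs → (xs ++ B) ++ m′ ∷ suc m′ ∷ []) (applyUpTo-∷ʳ suc a′) ⟩
      (applyUpTo suc a ++ B) ++ m′ ∷ suc m′ ∷ []  ≡⟨ cong (_++ m′ ∷ suc m′ ∷ []) (sym (applyUpTo-+ suc a k)) ⟩
      applyUpTo suc (a + k) ++ m′ ∷ suc m′ ∷ []   ≡⟨ sym (++-assoc (applyUpTo suc (a + k)) (m′ ∷ []) _) ⟩
      (applyUpTo suc (a + k) ∷ʳ m′) ∷ʳ suc m′     ≡⟨ cong (_∷ʳ suc m′) (applyUpTo-∷ʳ suc (a + k)) ⟩
      applyUpTo suc m′ ∷ʳ suc m′                  ≡⟨ applyUpTo-∷ʳ suc m′ ⟩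
      applyUpTo suc (suc m′)                      ≡⟨ sym (map-applyUpTo (λ i → i) suc (suc m′)) ⟩
      map suc (upTo (suc m′))                     ∎)))
    where open ≡-Reasoning

  topdrop-X++ : ∀ ys → topdrop (X ++ ys) ≡ ys ++ reverse X
  topdrop-X++ ys = topdrop-split L ys (cong suc (sym (length-applyUpTo suc a′)))

  Yʳ≡ : reverse Y ≡ suc m′ ∷ reverse (m′ ∷ B)
  Yʳ≡ = reverse-++ (m′ ∷ B) (suc m′ ∷ [])

  π₃≡π₀ʳ : π₃ ≡ reverse π₀
  π₃≡π₀ʳ = sym (reverse-++ X Y)

  first-π₃ : first π₃ ≡ suc m′
  first-π₃ = cong (λ zs → first (zs ++ reverse X)) Yʳ≡

  step₀ : topdrop π₀ ≡ π₁
  step₀ = topdrop-X++ Y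

  step₁ : topdrop π₁ ≡ π₂
  step₁ = trans (topdrop-reverse {π₁} (≤-reflexive (InS-length π₁∈S))) (reverse-++-reverse Y X)
    where
      π₁∈S : InS (suc m′) π₁
      π₁∈S = subst (InS (suc m′)) step₀ (InS-topdrop π₀∈S)

  step₂ : topdrop π₂ ≡ π₃
  step₂ = topdrop-X++ (reverse Y)

  |π₃|≤1+c₃ : length π₃ ≤ suc (first π₃)
  |π₃|≤1+c₃ = begin
    length π₃       ≡⟨ trans (cong length π₃≡π₀ʳ) (length-reverse π₀) ⟩
    length π₀       ≡⟨ InS-length π₀∈S ⟩
    suc m′          ≤⟨ n≤1+n (suc m′) ⟩
    suc (suc m′)    ≡⟨ cong suc (sym first-π₃) ⟩
    suc (first π₃)  ∎
    where open ≤-Reasoning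

  step₃ : topdrop π₃ ≡ π₀
  step₃ = begin
    topdrop π₃            ≡⟨ topdrop-reverse {π₃} |π₃|≤1+c₃ ⟩
    reverse π₃            ≡⟨ cong reverse π₃≡π₀ʳ ⟩
    reverse (reverse π₀)  ≡⟨ reverse-involutive π₀ ⟩
    π₀                    ∎
    where open ≡-Reasoning

  orbit : Orbit₄ m′ π₀ π₁ π₂ π₃
  orbit = record
    { π₀∈S = π₀∈S ; step₀ = step₀ ; step₁ = step₁ ; step₂ = step₂ ; step₃ = step₃
    ; π₀≢π₂ = λ π₀≡π₂ → 1+n≢n (sym (trans (cong first (++-cancelˡ X Y (reverse Y) π₀≡π₂)) (cong first Yʳ≡)))
    }

  necklace : necklace₄ π₀ π₁ π₂ π₃ ≡ a ∷ m′ ∷ a ∷ suc m′ ∷ []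
  necklace = cong (λ c₃ → a ∷ m′ ∷ a ∷ c₃ ∷ []) first-π₃

standard⇒valid : ∀ {n c} → StandardNecklace n c → TopdropValid n c
standard⇒valid {zero}          (_ , 1≤a , a≤0 , _) = ⊥-elim (<⇒≱ 1≤a a≤0)
standard⇒valid {suc zero}      (_ , 1≤a , a≤0 , _) = ⊥-elim (<⇒≱ 1≤a a≤0)
standard⇒valid {suc (suc n)}   (zero , () , _)
standard⇒valid {suc (suc n)} {c} (suc a′ , _ , a≤n , c~) with m≤n⇒∃[o]m+o≡n a≤n
... | k , refl = π₀ , π₀∈S , 4 , orbit₄-size orbit ,
  CyclicEq-sym (subst (CyclicEq c) (sym (trans (Orbit₄.neckSeq-π₀ orbit) necklace)) c~)
  where open Witness a′ k

lemma4p7 : (n : ℕ) (c : List ℕ) → length c ≡ 4 →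
    TopdropValid n c ⇔ (∃[ a ] (1 ≤ a × a ≤ n ∸ 2 × CyclicEq c (a ∷ n ∸ 1 ∷ a ∷ n ∷ [])))
lemma4p7 n c |c|≡4 = mk⇔ (valid⇒standard |c|≡4) standard⇒valid
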